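{- Let $\Bbbk$ be a commutative ring with unit $1\neq 0$ and without zero divisors. Let $p(x)=x^n+c_1x^{n-1}+\dots+c_n\in\Bbbk[x]$ be a monic polynomial which has all roots in $\Bbbk$, i.e. $p(x)=(x-\alpha_1)^{\mu_1}\cdots(x-\alpha_k)^{\mu_k}$ with pairwise distinct $\alpha_1,\dots,\alpha_k\in\Bbbk$ and integers $\mu_u\ge 1$. Let $S\subset \operatorname{Ker}p(L)$ be the $\Bbbk$-submodule generated by the sequences $s(\alpha_u,a)$, $1\le u\le k$, $0\le a\le\mu_u-1$. Then the quotient $\Bbbk$-module $\operatorname{Ker}p(L)/S$ is a torsion module, i.e. for every element $m$ of it there is a nonzero $c\in\Bbbk$ with $cm=0$.
   Context: $\mathfrak{S}_\Bbbk$ denotes the $\Bbbk$-module of all sequences $s=(s_0,s_1,\dots)$ of elements of $\Bbbk$ with termwise operations. For $s\in\mathfrak{S}_\Bbbk$ and $q(x)=\sum_i c_ix^i\in\Bbbk[x]$ put $\langle s,q\rangle=\sum_i c_i s_i$. The divided derivatives $\delta^m:\Bbbk[x]\to\Bbbk[x]$ are defined by $q(x+y)=\sum_{m\ge 0}(\delta^m q)(x)\,y^m$ in $\Bbbk[x,y]$. $D^m:\mathfrak{S}_\Bbbk\to\mathfrak{S}_\Bbbk$ is the unique map with $\langle D^m(s),q\rangle=\langle s,\delta^m(q)\rangle$ for all $s,q$. $L$ is the left shift $(Ls)_i=s_{i+1}$, and $p(L)=L^n+c_1L^{n-1}+\dots+c_n\,\mathrm{id}$. For $\alpha\in\Bbbk$,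 $s(\alpha)_i=\alpha^i$ (with $\alpha^0=1$) and $s(\alpha,m)=D^m(s(\alpha))$. -}

module Defs where

open import Level using (_⊔_)
open import Algebra.Bundles using (CommutativeRing)
open import Data.Nat as ℕ using (ℕ; zero; suc; _∸_; _≤?_)
open import Data.Nat.Combinatorics using (_C_)
open import Data.Fin using (Fin)
open import Data.List using (List; []; _∷_; reverse; foldr; map; allFin)
open import Data.Vec using (Vec; toList)
open import Data.Sum using (_⊎_)
open import Data.Product using (∃)
open import Relation.Nullary using (¬_; yes; no)

module _ {c ℓ} (R : CommutativeRing c ℓ) where
  open CommutativeRing R

  IsDomain : Set (c ⊔ ℓ)
  IsDomain = (¬ (1# ≈ 0#)) Data.Product.× (∀ x y → x * y ≈ 0# → x ≈ 0# ⊎ y ≈ 0#)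

  pow : Carrier → ℕ → Carrier
  pow x zero    = 1#
  pow x (suc n) = x * pow x n

  natR : ℕ → Carrier
  natR zero    = 0#
  natR (suc n) = 1# + natR n

  sumFin : (n : ℕ) → (Fin n → Carrier) → Carrier
  sumFin zero    f = 0#
  sumFin (suc n) f = f Data.Fin.zero + sumFin n (λ i → f (Data.Fin.suc i))

  Seq : Set c
  Seq = ℕ → Carrier

  _≋_ : Seq → Seq → Set ℓ
  s ≋ t = ∀ i → s i ≈ t i

  L : Seq → Seq
  L s i = s (suc i)

  -- polynomials: coefficient lists, lowest degree first
  Poly : Set c
  Poly = List Carrier

  coeff : Poly → ℕ → Carrier
  coeff []       _       = 0#
  coeff (a ∷ as) zero    = a
  coeff (a ∷ as) (suc i) = coeff as i

  _≈P_ : Poly → Poly → Set ℓ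
  p ≈P q = ∀ i → coeff p i ≈ coeff q i

  _+P_ : Poly → Poly → Poly
  []       +P q        = q
  (a ∷ p)  +P []       = a ∷ p
  (a ∷ p)  +P (b ∷ q)  = (a + b) ∷ (p +P q)

  scaleP : Carrier → Poly → Poly
  scaleP a p = map (a *_) p

  _*P_ : Poly → Poly → Poly
  []      *P q = []
  (a ∷ p) *P q = scaleP a q +P (0# ∷ (p *P q))

  powP : Poly → ℕ → Poly
  powP p zero    = 1# ∷ []
  powP p (suc n) = p *P powP p n

  linear : Carrier → Poly
  linear α = (- α) ∷ 1# ∷ []

  -- the monic polynomial x^n + c₁ x^{n-1} + … + c_n, given the vector (c₁,…,c_n)
  monic : {n : ℕ} → Vec Carrier n → Poly
  monic cs = reverse (1# ∷ toList cs)

  rootProduct : (k : ℕ) → (Fin k → Carrier) → (Fin k → ℕ) → Poly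
  rootProduct k α μ = foldr (λ u r → powP (linear (α u)) (μ u) *P r) (1# ∷ []) (allFin k)

  evalL : Poly → Seq → Seq
  evalL []       s i = 0#
  evalL (a ∷ as) s i = a * s i + evalL as (L s) i

  InKer : Poly → Seq → Set ℓ
  InKer p s = evalL p s ≋ (λ _ → 0#)

  geom : Carrier → Seq
  geom α i = pow α i

  -- divided-derivative dual D^m: ⟨D^m s, x^i⟩ = ⟨s, δ^m x^i⟩ = (i choose m) s_{i-m}
  -- (δ^m x^i = (i choose m) x^{i-m}, and 0 if i < m)
  D : ℕ → Seq → Seq
  D m s i with m ≤? i
  ... | yes _ = natR (i C m) * s (i ∸ m)
  ... | no  _ = 0#

  sαm : Carrier → ℕ → Seq
  sαm α m = D m (geom α)

  InSpan : (k : ℕ) → (Fin k → Carrier) → (Fin k → ℕ) → Seq → Set (c ⊔ ℓ)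
  InSpan k α μ s =
    ∃ λ (λc : (u : Fin k) → Fin (μ u) → Carrier) →
      s ≋ (λ i → sumFin k (λ u → sumFin (μ u) (λ a → λc u a * sαm (α u) (Data.Fin.toℕ a) i)))

-- Write P = ∏ (L - αᵤ)^μᵤ and induct on the number k of roots. The sequences
-- s(γ, a), a < m, span exactly the kernel of (L - γ)^m, since L - γ sends s(γ, a + 1)
-- to s(γ, a) and s(γ, 0) to 0. For γ different from α, the operator L - α acts on that
-- span as (γ - α) plus a nilpotent part, so it is onto up to a nonzero scalar, and
-- hence so is every product of such factors. Now if P s = 0 and Q is the product of
-- the factors for the roots other than α₁, then Q s lies in the span for α₁, so
-- e · Q s = Q y for some y in that span and e ≠ 0; then e s - y lies in the kernel
-- of Q, and induction finishes the argument.
module Submission where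

open import Algebra.Bundles using (CommutativeRing)
open import Data.Fin as Fin using (Fin; toℕ; fromℕ<)
open import Data.Fin.Properties using (toℕ-fromℕ<; toℕ<n; suc-injective)
open import Data.List using ([]; _∷_; foldr; allFin)
open import Data.List.Properties using (foldr-map; map-tabulate)
open import Data.Nat as ℕ using (ℕ; zero; suc; _∸_; _<_; _≥_; _≤?_; s≤s; z≤n)
open import Data.Nat.Combinatorics using (_C_; k>n⇒nCk≡0; nCk+nC[k+1]≡[n+1]C[k+1])
open import Data.Nat.Properties using (+-∸-assoc; ≰⇒>; <⇒≤)
open import Data.Product using (∃; _×_; _,_; proj₁; proj₂)
open import Data.Sum using ([_,_])
open import Data.Vec using (Vec)
open import Function using (_∘_; id)
open import Level using (_⊔_) renaming (suc to lsuc)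
open import Relation.Binary.PropositionalEquality as ≡ using (_≡_)
open import Relation.Nullary using (¬_; yes; no)

open import Defs

module _ {c ℓ} (R : CommutativeRing c ℓ) where
  open CommutativeRing R hiding (zero)
  open import Algebra.Properties.Ring ring using (-1*x≈-x)
  open import Algebra.Properties.AbelianGroup +-abelianGroup
    using (xyx⁻¹≈y; //-rightDividesˡ; //-rightDividesʳ; x∙y⁻¹≈ε⇒x≈y)
  open import Algebra.Properties.CommutativeSemigroup +-commutativeSemigroup
    using (interchange)
  open import Algebra.Properties.CommutativeSemigroup *-commutativeSemigroup
    using (x∙yz≈y∙xz)
  open import Algebra.Properties.Semiring.Sum semiring
    using (sum; sum-cong-≋; sum-replicate-zero; ∑-distrib-+; *-distribˡ-sum)
  open import Algebra.Solver.Ring.NaturalCoefficients.Default commutativeSemiring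
    using (solve; _:=_; _:+_; _:*_; con)
  open import Relation.Binary.Reasoning.Setoid setoid

  infix  4 _∼_
  infixl 6 _⊕_ _⊖_
  infixr 7 _⊙_

  _∼_ : Seq R → Seq R → Set ℓ
  _∼_ = _≋_ R

  𝟎 : Seq R
  𝟎 _ = 0#

  _⊕_ _⊖_ : Seq R → Seq R → Seq R
  (x ⊕ y) i = x i + y i
  (x ⊖ y) i = x i - y i

  _⊙_ : Carrier → Seq R → Seq R
  (a ⊙ x) i = a * x i

  ∼-sym : ∀ {x y} → x ∼ y → y ∼ x
  ∼-sym x∼y i = sym (x∼y i)

  ∼-trans : ∀ {x y z} → x ∼ y → y ∼ z → x ∼ z
  ∼-trans x∼y y∼z i = trans (x∼y i) (y∼z i)

  ⊙-⊕-⊖ : ∀ f e x y → f ⊙ y ⊕ f ⊙ (e ⊙ x ⊖ y) ∼ (f * e) ⊙ x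
  ⊙-⊕-⊖ f e x y i = begin
    f * y i + f * (e * x i - y i)  ≈⟨ distribˡ f _ _ ⟨
    f * (y i + (e * x i - y i))    ≈⟨ *-congˡ (trans (+-comm _ _) (//-rightDividesˡ (y i) _)) ⟩
    f * (e * x i)                  ≈⟨ *-assoc f e (x i) ⟨
    f * e * x i                    ∎

  SeqPred : Set (lsuc (c ⊔ ℓ))
  SeqPred = Seq R → Set (c ⊔ ℓ)

  record IsSubmodule (P : SeqPred) : Set (c ⊔ ℓ) where
    field
      ∼-resp   : ∀ {x y} → x ∼ y → P x → P y
      𝟎-closed : P 𝟎
      ⊕-closed : ∀ {x y} → P x → P y → P (x ⊕ y)
      ⊙-closed : ∀ a {x} → P x → P (a ⊙ x)

    ⊖-closed : ∀ {x y} → P x → P y → P (x ⊖ y)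
    ⊖-closed {y = y} x∈ y∈ =
      ∼-resp (λ i → +-congˡ (-1*x≈-x (y i))) (⊕-closed x∈ (⊙-closed (- 1#) y∈))

  record IsLinear (F : Seq R → Seq R) : Set (c ⊔ ℓ) where
    field
      cong   : ∀ {x y} → x ∼ y → F x ∼ F y
      ⊕-homo : ∀ x y → F (x ⊕ y) ∼ F x ⊕ F y
      ⊙-homo : ∀ a x → F (a ⊙ x) ∼ a ⊙ F x

    𝟎-homo : F 𝟎 ∼ 𝟎
    𝟎-homo i = begin
      F 𝟎 i         ≈⟨ cong (λ _ → sym (zeroˡ 0#)) i ⟩
      F (0# ⊙ 𝟎) i  ≈⟨ ⊙-homo 0# 𝟎 i ⟩
      0# * F 𝟎 i    ≈⟨ zeroˡ _ ⟩
      0#            ∎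

    ⊖-homo : ∀ x y → F (x ⊖ y) ∼ F x ⊖ F y
    ⊖-homo x y i = begin
      F (x ⊖ y) i               ≈⟨ cong (λ j → +-congˡ (sym (-1*x≈-x (y j)))) i ⟩
      F (x ⊕ (- 1#) ⊙ y) i      ≈⟨ ⊕-homo x _ i ⟩
      F x i + F ((- 1#) ⊙ y) i  ≈⟨ +-congˡ (trans (⊙-homo (- 1#) y i) (-1*x≈-x _)) ⟩
      F x i - F y i             ∎

    ⊖-kernel : ∀ {x y} → F x ∼ F y → F (x ⊖ y) ∼ 𝟎
    ⊖-kernel {x} {y} Fx∼Fy i =
      trans (⊖-homo x y i) (trans (+-congʳ (Fx∼Fy i)) (-‿inverseʳ _))

  Image : (Seq R → Seq R) → SeqPred → SeqPred
  Image F X y = ∃ λ x → X x × F x ∼ y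

  image-isSubmodule : ∀ {F X} → IsLinear F → IsSubmodule X → IsSubmodule (Image F X)
  image-isSubmodule lin sub = record
    { ∼-resp   = λ { y∼z (x , x∈ , Fx∼y) → x , x∈ , ∼-trans Fx∼y y∼z }
    ; 𝟎-closed = 𝟎 , 𝟎-closed , 𝟎-homo
    ; ⊕-closed = λ { (x , x∈ , Fx∼) (y , y∈ , Fy∼) →
        x ⊕ y , ⊕-closed x∈ y∈ , λ i → trans (⊕-homo x y i) (+-cong (Fx∼ i) (Fy∼ i)) }
    ; ⊙-closed = λ { a (x , x∈ , Fx∼) →
        a ⊙ x , ⊙-closed a x∈ , λ i → trans (⊙-homo a x i) (*-congˡ (Fx∼ i)) }
    }
    where
    open IsLinear lin
    open IsSubmodule sub

  lincomb : (m : ℕ) → (Fin m → Seq R) → (Fin m → Carrier) → Seq R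
  lincomb m g κ i = sum (λ a → κ a * g a i)

  Span : (m : ℕ) → (Fin m → Seq R) → SeqPred
  Span m g x = ∃ λ κ → x ∼ lincomb m g κ

  δ : ∀ {m} → Fin m → Fin m → Carrier
  δ Fin.zero    Fin.zero    = 1#
  δ Fin.zero    (Fin.suc _) = 0#
  δ (Fin.suc _) Fin.zero    = 0#
  δ (Fin.suc a) (Fin.suc b) = δ a b

  sum-0* : ∀ {m} (f : Fin m → Carrier) → sum (λ a → 0# * f a) ≈ 0#
  sum-0* {m} f = trans (sum-cong-≋ {y = λ _ → 0#} (λ a → zeroˡ (f a))) (sum-replicate-zero m)

  sum-δ* : ∀ {m} (a : Fin m) (f : Fin m → Carrier) → sum (λ b → δ a b * f b) ≈ f a
  sum-δ* Fin.zero    f = trans (+-cong (*-identityˡ _) (sum-0* (f ∘ Fin.suc))) (+-identityʳ _)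
  sum-δ* (Fin.suc a) f = trans (+-cong (zeroˡ _) (sum-δ* a (f ∘ Fin.suc))) (+-identityˡ _)

  span-isSubmodule : ∀ m g → IsSubmodule (Span m g)
  span-isSubmodule m g = record
    { ∼-resp   = λ { x∼y (κ , x∼) → κ , ∼-trans (∼-sym x∼y) x∼ }
    ; 𝟎-closed = (λ _ → 0#) , λ i → sym (sum-0* (λ a → g a i))
    ; ⊕-closed = λ { (κ , x∼) (κ′ , y∼) → (λ a → κ a + κ′ a) , λ i →
        trans (+-cong (x∼ i) (y∼ i))
              (trans (sym (∑-distrib-+ (λ a → κ a * g a i) (λ a → κ′ a * g a i)))
                     (sum-cong-≋ (λ a → sym (distribʳ (g a i) (κ a) (κ′ a))))) }
    ; ⊙-closed = λ { b (κ , x∼) → (λ a → b * κ a) , λ i →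
        trans (*-congˡ (x∼ i))
              (trans (*-distribˡ-sum b (λ a → κ a * g a i))
                     (sum-cong-≋ (λ a → sym (*-assoc b (κ a) (g a i))))) }
    }

  span-∋-generator : ∀ {m} g (a : Fin m) → Span m g (g a)
  span-∋-generator g a = δ a , λ i → sym (sum-δ* a (λ b → g b i))

  lincomb-closed : ∀ {P} → IsSubmodule P → ∀ m g → (∀ a → P (g a)) → ∀ κ → P (lincomb m g κ)
  lincomb-closed sub zero    g g∈ κ = IsSubmodule.𝟎-closed sub
  lincomb-closed sub (suc m) g g∈ κ =
    ⊕-closed (⊙-closed (κ Fin.zero) (g∈ Fin.zero))
             (lincomb-closed sub m (g ∘ Fin.suc) (g∈ ∘ Fin.suc) (κ ∘ Fin.suc))
    where open IsSubmodule sub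

  span-minimal : ∀ {P} → IsSubmodule P → ∀ {m g} → (∀ a → P (g a)) → ∀ {x} → Span m g x → P x
  span-minimal sub g∈ (κ , x∼) = IsSubmodule.∼-resp sub (∼-sym x∼) (lincomb-closed sub _ _ g∈ κ)

  evalL-cong : ∀ p {x y} → x ∼ y → evalL R p x ∼ evalL R p y
  evalL-cong []      x∼y i = refl
  evalL-cong (a ∷ p) x∼y i = +-cong (*-congˡ (x∼y i)) (evalL-cong p (x∼y ∘ suc) i)

  evalL-isLinear : ∀ p → IsLinear (evalL R p)
  evalL-isLinear p = record { cong = evalL-cong p ; ⊕-homo = ⊕-homo p ; ⊙-homo = ⊙-homo p }
    where
    ⊕-homo : ∀ p x y → evalL R p (x ⊕ y) ∼ evalL R p x ⊕ evalL R p y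
    ⊕-homo []      x y i = sym (+-identityʳ 0#)
    ⊕-homo (a ∷ p) x y i =
      trans (+-cong (distribˡ a (x i) (y i)) (⊕-homo p (L R x) (L R y) i)) (interchange _ _ _ _)

    ⊙-homo : ∀ p b x → evalL R p (b ⊙ x) ∼ b ⊙ evalL R p x
    ⊙-homo []      b x i = sym (zeroʳ b)
    ⊙-homo (a ∷ p) b x i =
      trans (+-cong (x∙yz≈y∙xz a b (x i)) (⊙-homo p b (L R x) i)) (sym (distribˡ b _ _))

  evalL-L : ∀ p x → evalL R p (L R x) ∼ L R (evalL R p x)
  evalL-L []      x i = refl
  evalL-L (a ∷ p) x i = +-congˡ (evalL-L p (L R x) i)

  evalL-+P : ∀ p q x → evalL R (_+P_ R p q) x ∼ evalL R p x ⊕ evalL R q x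
  evalL-+P []      q       x i = sym (+-identityˡ _)
  evalL-+P (a ∷ p) []      x i = sym (+-identityʳ _)
  evalL-+P (a ∷ p) (b ∷ q) x i =
    trans (+-cong (distribʳ (x i) a b) (evalL-+P p q (L R x) i)) (interchange _ _ _ _)

  evalL-scaleP : ∀ a p x → evalL R (scaleP R a p) x ∼ a ⊙ evalL R p x
  evalL-scaleP a []      x i = sym (zeroʳ a)
  evalL-scaleP a (b ∷ p) x i =
    trans (+-cong (*-assoc a b (x i)) (evalL-scaleP a p (L R x) i)) (sym (distribˡ a _ _))

  evalL-*P : ∀ p q x → evalL R (_*P_ R p q) x ∼ evalL R p (evalL R q x)
  evalL-*P []      q x i = refl
  evalL-*P (a ∷ p) q x i = begin
    evalL R (_+P_ R (scaleP R a q) (0# ∷ _*P_ R p q)) x i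
      ≈⟨ evalL-+P (scaleP R a q) (0# ∷ _*P_ R p q) x i ⟩
    evalL R (scaleP R a q) x i + (0# * x i + evalL R (_*P_ R p q) (L R x) i)
      ≈⟨ +-cong (evalL-scaleP a q x i) (trans (+-congʳ (zeroˡ _)) (+-identityˡ _)) ⟩
    a * evalL R q x i + evalL R (_*P_ R p q) (L R x) i
      ≈⟨ +-congˡ (evalL-*P p q (L R x) i) ⟩
    a * evalL R q x i + evalL R p (evalL R q (L R x)) i
      ≈⟨ +-congˡ (evalL-cong p (evalL-L q x) i) ⟩
    a * evalL R q x i + evalL R p (L R (evalL R q x)) i
      ∎

  evalL-unit : ∀ x → evalL R (1# ∷ []) x ∼ x
  evalL-unit x i = trans (+-identityʳ _) (*-identityˡ _)

  evalL-null : ∀ p → (∀ i → coeff R p i ≈ 0#) → ∀ x → evalL R p x ∼ 𝟎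
  evalL-null []      p≈0 x i = refl
  evalL-null (a ∷ p) p≈0 x i =
    trans (+-cong (trans (*-congʳ (p≈0 0)) (zeroˡ _)) (evalL-null p (p≈0 ∘ suc) (L R x) i))
          (+-identityʳ 0#)

  evalL-≈P : ∀ p q → _≈P_ R p q → ∀ x → evalL R p x ∼ evalL R q x
  evalL-≈P []      q       p≈q x i = sym (evalL-null q (sym ∘ p≈q) x i)
  evalL-≈P (a ∷ p) []      p≈q x i = evalL-null (a ∷ p) p≈q x i
  evalL-≈P (a ∷ p) (b ∷ q) p≈q x i =
    +-cong (*-congʳ (p≈q 0)) (evalL-≈P p q (p≈q ∘ suc) (L R x) i)

  evalL-comm : ∀ p q x → evalL R p (evalL R q x) ∼ evalL R q (evalL R p x)
  evalL-comm p []      x = IsLinear.𝟎-homo (evalL-isLinear p)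
  evalL-comm p (b ∷ q) x i = begin
    evalL R p (b ⊙ x ⊕ evalL R q (L R x)) i
      ≈⟨ ⊕-homo _ _ i ⟩
    evalL R p (b ⊙ x) i + evalL R p (evalL R q (L R x)) i
      ≈⟨ +-cong (⊙-homo b x i) (evalL-comm p q (L R x) i) ⟩
    b * evalL R p x i + evalL R q (evalL R p (L R x)) i
      ≈⟨ +-congˡ (evalL-cong q (evalL-L p x) i) ⟩
    b * evalL R p x i + evalL R q (L R (evalL R p x)) i
      ∎
    where open IsLinear (evalL-isLinear p)

  rootProduct-suc : ∀ {k} α μ →
    rootProduct R (suc k) α μ ≡
    _*P_ R (powP R (linear R (α Fin.zero)) (μ Fin.zero))
           (rootProduct R k (α ∘ Fin.suc) (μ ∘ Fin.suc))
  rootProduct-suc {k} α μ = ≡.cong (_*P_ R (factor Fin.zero))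
    (≡.trans (≡.cong (foldr step (1# ∷ [])) (≡.sym (map-tabulate id Fin.suc)))
             (foldr-map step Fin.suc (1# ∷ []) (allFin k)))
    where
    factor : Fin (suc k) → Poly R
    factor u = powP R (linear R (α u)) (μ u)
    step : Fin (suc k) → Poly R → Poly R
    step u = _*P_ R (factor u)

  Δ : Carrier → Seq R → Seq R
  Δ γ = evalL R (linear R γ)

  Δ-step : ∀ γ x i → Δ γ x i + γ * x i ≈ x (suc i)
  Δ-step γ x i = begin
    (- γ * x i + (1# * x (suc i) + 0#)) + γ * x i
      ≈⟨ solve 4 (λ γ′ γ u v → (γ′ :* u :+ (con 1 :* v :+ con 0)) :+ γ :* u
                              := v :+ (γ′ :+ γ) :* u) refl (- γ) γ (x i) (x (suc i)) ⟩
    x (suc i) + (- γ + γ) * x i   ≈⟨ +-congˡ (trans (*-congʳ (-‿inverseˡ γ)) (zeroˡ _)) ⟩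
    x (suc i) + 0#                ≈⟨ +-identityʳ _ ⟩
    x (suc i)                     ∎

  Δ-from-recurrence : ∀ {γ x y} → (∀ i → x (suc i) ≈ y i + γ * x i) → Δ γ x ∼ y
  Δ-from-recurrence {γ} {x} {y} recurrence i = begin
    Δ γ x i                         ≈⟨ //-rightDividesʳ (γ * x i) (Δ γ x i) ⟨
    (Δ γ x i + γ * x i) - γ * x i   ≈⟨ +-congʳ (trans (Δ-step γ x i) (recurrence i)) ⟩
    (y i + γ * x i) - γ * x i       ≈⟨ //-rightDividesʳ (γ * x i) (y i) ⟩
    y i                             ∎

  Δ-shift : ∀ α γ x → Δ α x ∼ Δ γ x ⊕ (γ - α) ⊙ x
  Δ-shift α γ x = Δ-from-recurrence λ i → begin
    x (suc i)                                ≈⟨ Δ-step γ x i ⟨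
    Δ γ x i + γ * x i                        ≈⟨ +-congˡ (*-congʳ (//-rightDividesˡ α γ)) ⟨
    Δ γ x i + ((γ - α) + α) * x i            ≈⟨ +-congˡ (distribʳ _ _ _) ⟩
    Δ γ x i + ((γ - α) * x i + α * x i)      ≈⟨ +-assoc _ _ _ ⟨
    (Δ γ x i + (γ - α) * x i) + α * x i      ∎

  natR-+ : ∀ m n → natR R (m ℕ.+ n) ≈ natR R m + natR R n
  natR-+ zero    n = sym (+-identityˡ _)
  natR-+ (suc m) n = trans (+-congˡ (natR-+ m n)) (sym (+-assoc _ _ _))

  sαm-formula : ∀ β b i → sαm R β b i ≈ natR R (i C b) * pow R β (i ∸ b)
  sαm-formula β b i with b ≤? i
  ... | yes _  = refl
  ... | no b≰i rewrite k>n⇒nCk≡0 (≰⇒> b≰i) = sym (zeroˡ _)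

  sαm-zero : ∀ β i → sαm R β 0 i ≈ pow R β i
  sαm-zero β i = trans (sαm-formula β 0 i) (trans (*-congʳ (+-identityʳ 1#)) (*-identityˡ _))

  -- For i ≤ b truncated subtraction breaks β^(i ∸ b) = β · β^(i ∸ (b + 1)),
  -- but then i C (b + 1) = 0.
  C-pow-shift : ∀ β b i →
    natR R (i C suc b) * pow R β (i ∸ b) ≈ β * (natR R (i C suc b) * pow R β (i ∸ suc b))
  C-pow-shift β b zero = trans (zeroˡ _) (sym (trans (*-congˡ (zeroˡ _)) (zeroʳ β)))
  C-pow-shift β b (suc i) with b ≤? i
  ... | yes b≤i rewrite +-∸-assoc 1 b≤i = x∙yz≈y∙xz _ β _
  ... | no b≰i rewrite k>n⇒nCk≡0 (s≤s (≰⇒> b≰i)) =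
    trans (zeroˡ _) (sym (trans (*-congˡ (zeroˡ _)) (zeroʳ β)))

  Δ-sαm-zero : ∀ β → Δ β (sαm R β 0) ∼ 𝟎
  Δ-sαm-zero β = Δ-from-recurrence λ i → begin
    sαm R β 0 (suc i)      ≈⟨ sαm-zero β (suc i) ⟩
    β * pow R β i          ≈⟨ *-congˡ (sαm-zero β i) ⟨
    β * sαm R β 0 i        ≈⟨ +-identityˡ _ ⟨
    0# + β * sαm R β 0 i   ∎

  Δ-sαm-suc : ∀ β b → Δ β (sαm R β (suc b)) ∼ sαm R β b
  Δ-sαm-suc β b = Δ-from-recurrence λ i → begin
    sαm R β (suc b) (suc i)
      ≈⟨ sαm-formula β (suc b) (suc i) ⟩
    natR R (suc i C suc b) * pow R β (i ∸ b)
      ≈⟨ *-congʳ (reflexive (≡.cong (natR R) (≡.sym (nCk+nC[k+1]≡[n+1]C[k+1] i b)))) ⟩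
    natR R (i C b ℕ.+ i C suc b) * pow R β (i ∸ b)
      ≈⟨ trans (*-congʳ (natR-+ (i C b) (i C suc b))) (distribʳ _ _ _) ⟩
    natR R (i C b) * pow R β (i ∸ b) + natR R (i C suc b) * pow R β (i ∸ b)
      ≈⟨ +-congˡ (C-pow-shift β b i) ⟩
    natR R (i C b) * pow R β (i ∸ b) + β * (natR R (i C suc b) * pow R β (i ∸ suc b))
      ≈⟨ +-cong (sαm-formula β b i) (*-congˡ (sαm-formula β (suc b) i)) ⟨
    sαm R β b i + β * sαm R β (suc b) i
      ∎

  Δ-kernel : ∀ γ {z} → Δ γ z ∼ 𝟎 → z ∼ z 0 ⊙ sαm R γ 0
  Δ-kernel γ {z} Δz∼𝟎 i = trans (geometric i) (*-congˡ (sym (sαm-zero γ i)))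
    where
    geometric : ∀ i → z i ≈ z 0 * pow R γ i
    geometric zero    = sym (*-identityʳ _)
    geometric (suc i) = begin
      z (suc i)                   ≈⟨ Δ-step γ z i ⟨
      Δ γ z i + γ * z i           ≈⟨ +-cong (Δz∼𝟎 i) (*-congˡ (geometric i)) ⟩
      0# + γ * (z 0 * pow R γ i)  ≈⟨ +-identityˡ _ ⟩
      γ * (z 0 * pow R γ i)       ≈⟨ x∙yz≈y∙xz γ (z 0) _ ⟩
      z 0 * (γ * pow R γ i)       ∎

  RootSpan : Carrier → ℕ → SeqPred
  RootSpan γ m = Span m (λ a → sαm R γ (toℕ a))

  rootSpan-isSubmodule : ∀ γ m → IsSubmodule (RootSpan γ m)
  rootSpan-isSubmodule γ m = span-isSubmodule m (λ a → sαm R γ (toℕ a))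

  sαm∈RootSpan : ∀ γ {m b} → b < m → RootSpan γ m (sαm R γ b)
  sαm∈RootSpan γ {m} b<m = ≡.subst (λ b → RootSpan γ m (sαm R γ b)) (toℕ-fromℕ< b<m)
    (span-∋-generator (λ a → sαm R γ (toℕ a)) (fromℕ< b<m))

  Δ^ : ℕ → Carrier → Seq R → Seq R
  Δ^ m γ = evalL R (powP R (linear R γ) m)

  Δ^-kernel⊆RootSpan : ∀ m γ {x} → Δ^ m γ x ∼ 𝟎 → RootSpan γ m x
  Δ^-kernel⊆RootSpan zero γ {x} x∈ker =
    ∼-resp (λ i → sym (trans (sym (evalL-unit x i)) (x∈ker i))) 𝟎-closed
    where open IsSubmodule (rootSpan-isSubmodule γ 0)
  Δ^-kernel⊆RootSpan (suc m) γ {x} x∈ker =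
    let (y , y∈ , Δy∼Δx) = lift (Δ^-kernel⊆RootSpan m γ Δx∈ker)
        x-y∈ = ∼-resp (∼-sym (Δ-kernel γ (⊖-kernel (∼-sym Δy∼Δx))))
                      (⊙-closed _ (sαm∈RootSpan γ (s≤s z≤n)))
    in ∼-resp (λ i → //-rightDividesˡ (y i) (x i)) (⊕-closed x-y∈ y∈)
    where
    open IsSubmodule (rootSpan-isSubmodule γ (suc m))
    open IsLinear (evalL-isLinear (linear R γ)) using (⊖-kernel)

    Δx∈ker : Δ^ m γ (Δ γ x) ∼ 𝟎
    Δx∈ker i = begin
      Δ^ m γ (Δ γ x) i  ≈⟨ evalL-comm (powP R (linear R γ) m) (linear R γ) x i ⟩
      Δ γ (Δ^ m γ x) i  ≈⟨ evalL-*P (linear R γ) (powP R (linear R γ) m) x i ⟨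
      Δ^ (suc m) γ x i  ≈⟨ x∈ker i ⟩
      0#                ∎

    lift : ∀ {w} → RootSpan γ m w → Image (Δ γ) (RootSpan γ (suc m)) w
    lift = span-minimal
      (image-isSubmodule (evalL-isLinear (linear R γ)) (rootSpan-isSubmodule γ (suc m)))
      λ a → sαm R γ (suc (toℕ a)) , span-∋-generator (λ a → sαm R γ (toℕ a)) (Fin.suc a) ,
            Δ-sαm-suc γ (toℕ a)

  rootProduct-suc-kernel : ∀ {k} α μ {s} → evalL R (rootProduct R (suc k) α μ) s ∼ 𝟎 →
    RootSpan (α Fin.zero) (μ Fin.zero) (evalL R (rootProduct R k (α ∘ Fin.suc) (μ ∘ Fin.suc)) s)
  rootProduct-suc-kernel {k} α μ {s} s∈ker = Δ^-kernel⊆RootSpan (μ Fin.zero) (α Fin.zero) λ i →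
    trans (sym (evalL-*P (powP R (linear R (α Fin.zero)) (μ Fin.zero)) Q s i))
          (≡.subst (λ p → evalL R p s ∼ 𝟎) (rootProduct-suc α μ) s∈ker i)
    where
    Q : Poly R
    Q = rootProduct R k (α ∘ Fin.suc) (μ ∘ Fin.suc)

  Torsion : SeqPred → SeqPred
  Torsion P x = ∃ λ e → ¬ e ≈ 0# × P (e ⊙ x)

  SurjectiveModTorsion : (Seq R → Seq R) → SeqPred → Set (c ⊔ ℓ)
  SurjectiveModTorsion F X = ∀ {x} → X x → Torsion (Image F X) x

  surjectiveModTorsion⇒kernel : ∀ {F X s} → IsLinear F → SurjectiveModTorsion F X → X (F s) →
    ∃ λ e → ¬ e ≈ 0# × ∃ λ y → X y × F (e ⊙ s ⊖ y) ∼ 𝟎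
  surjectiveModTorsion⇒kernel {s = s} lin F-onto Fs∈ =
    let (e , e≉0 , y , y∈ , Fy∼eFs) = F-onto Fs∈
    in e , e≉0 , y , y∈ , ⊖-kernel (λ i → trans (⊙-homo e s i) (sym (Fy∼eFs i)))
    where open IsLinear lin

  sumFin≡sum : ∀ n (f : Fin n → Carrier) → sumFin R n f ≡ sum f
  sumFin≡sum zero    f = ≡.refl
  sumFin≡sum (suc n) f = ≡.cong (f Fin.zero +_) (sumFin≡sum n (f ∘ Fin.suc))

  InSpan-resp : ∀ {k} α μ {x y} → x ∼ y → InSpan R k α μ x → InSpan R k α μ y
  InSpan-resp α μ x∼y (κ , x∼) = κ , ∼-trans (∼-sym x∼y) x∼

  InSpan-suc : ∀ {k} α μ {x y} → RootSpan (α Fin.zero) (μ Fin.zero) x →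
    InSpan R k (α ∘ Fin.suc) (μ ∘ Fin.suc) y → InSpan R (suc k) α μ (x ⊕ y)
  InSpan-suc {k} α μ (κ , x∼) (κ′ , y∼) = coefficients , λ i →
    +-cong (trans (x∼ i) (reflexive (≡.sym (sumFin≡sum (μ Fin.zero) _)))) (y∼ i)
    where
    coefficients : (u : Fin (suc k)) → Fin (μ u) → Carrier
    coefficients Fin.zero    = κ
    coefficients (Fin.suc u) = κ′ u

  module _ (domain : IsDomain R) where

    *-nonzero : ∀ {a b} → ¬ a ≈ 0# → ¬ b ≈ 0# → ¬ a * b ≈ 0#
    *-nonzero a≉0 b≉0 ab≈0 = [ a≉0 , b≉0 ] (proj₂ domain _ _ ab≈0)

    torsion-isSubmodule : ∀ {P} → IsSubmodule P → IsSubmodule (Torsion P)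
    torsion-isSubmodule sub = record
      { ∼-resp   = λ { x∼y (e , e≉0 , ex∈) →
          e , e≉0 , ∼-resp (λ i → *-congˡ (x∼y i)) ex∈ }
      ; 𝟎-closed = 1# , proj₁ domain , ∼-resp (λ i → sym (zeroʳ 1#)) 𝟎-closed
      ; ⊕-closed = λ { {x} {y} (e , e≉0 , ex∈) (f , f≉0 , fy∈) →
          e * f , *-nonzero e≉0 f≉0 ,
          ∼-resp (λ i → regroup e f (x i) (y i)) (⊕-closed (⊙-closed f ex∈) (⊙-closed e fy∈)) }
      ; ⊙-closed = λ { a {x} (e , e≉0 , ex∈) →
          e , e≉0 , ∼-resp (λ i → x∙yz≈y∙xz a e (x i)) (⊙-closed a ex∈) }
      }
      where
      open IsSubmodule sub
      regroup : ∀ e f u v → f * (e * u) + e * (f * v) ≈ (e * f) * (u + v)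
      regroup = solve 4 (λ e f u v → f :* (e :* u) :+ e :* (f :* v) := (e :* f) :* (u :+ v)) refl

    ∘-surjectiveModTorsion : ∀ {F G X} → IsLinear F →
      SurjectiveModTorsion F X → SurjectiveModTorsion G X → SurjectiveModTorsion (F ∘ G) X
    ∘-surjectiveModTorsion {F} {G} lin F-onto G-onto {x} x∈ =
      let (e , e≉0 , y , y∈ , Fy∼ex) = F-onto x∈
          (f , f≉0 , z , z∈ , Gz∼fy) = G-onto y∈
      in f * e , *-nonzero f≉0 e≉0 , z , z∈ , λ i → begin
        F (G z) i       ≈⟨ cong Gz∼fy i ⟩
        F (f ⊙ y) i     ≈⟨ ⊙-homo f y i ⟩
        f * F y i       ≈⟨ *-congˡ (Fy∼ex i) ⟩
        f * (e * x i)   ≈⟨ *-assoc f e (x i) ⟨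
        f * e * x i     ∎
      where open IsLinear lin

    surjectiveModTorsion-cong : ∀ {F G X} → (∀ x → F x ∼ G x) →
      SurjectiveModTorsion F X → SurjectiveModTorsion G X
    surjectiveModTorsion-cong F∼G F-onto x∈ =
      let (e , e≉0 , y , y∈ , Fy∼ex) = F-onto x∈
      in e , e≉0 , y , y∈ , ∼-trans (∼-sym (F∼G y)) Fy∼ex

    unit-surjectiveModTorsion : ∀ {X} → SurjectiveModTorsion (evalL R (1# ∷ [])) X
    unit-surjectiveModTorsion {x = x} x∈ =
      1# , proj₁ domain , x , x∈ , λ i → trans (evalL-unit x i) (sym (*-identityˡ _))

    *P-surjectiveModTorsion : ∀ p q {X} → SurjectiveModTorsion (evalL R p) X →
      SurjectiveModTorsion (evalL R q) X → SurjectiveModTorsion (evalL R (_*P_ R p q)) X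
    *P-surjectiveModTorsion p q p-onto q-onto =
      surjectiveModTorsion-cong (λ x → ∼-sym (evalL-*P p q x))
        (∘-surjectiveModTorsion (evalL-isLinear p) p-onto q-onto)

    powP-surjectiveModTorsion : ∀ p m {X} → SurjectiveModTorsion (evalL R p) X →
      SurjectiveModTorsion (evalL R (powP R p m)) X
    powP-surjectiveModTorsion p zero    p-onto = unit-surjectiveModTorsion
    powP-surjectiveModTorsion p (suc m) p-onto =
      *P-surjectiveModTorsion p (powP R p m) p-onto (powP-surjectiveModTorsion p m p-onto)

    rootProduct-surjectiveModTorsion : ∀ k α μ {X} →
      (∀ u → SurjectiveModTorsion (Δ^ (μ u) (α u)) X) →
      SurjectiveModTorsion (evalL R (rootProduct R k α μ)) X
    rootProduct-surjectiveModTorsion zero    α μ factors-onto = unit-surjectiveModTorsion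
    rootProduct-surjectiveModTorsion (suc k) α μ factors-onto rewrite rootProduct-suc α μ =
      *P-surjectiveModTorsion (powP R (linear R (α Fin.zero)) (μ Fin.zero))
        (rootProduct R k (α ∘ Fin.suc) (μ ∘ Fin.suc)) (factors-onto Fin.zero)
        (rootProduct-surjectiveModTorsion k (α ∘ Fin.suc) (μ ∘ Fin.suc) (factors-onto ∘ Fin.suc))

    Δ-onto-sαm : ∀ α γ {m} → ¬ γ - α ≈ 0# → ∀ b → b < m →
      Torsion (Image (Δ α) (RootSpan γ m)) (sαm R γ b)
    Δ-onto-sαm α γ γ≉α zero 0<m =
      γ - α , γ≉α , sαm R γ 0 , sαm∈RootSpan γ 0<m , λ i → begin
        Δ α (sαm R γ 0) i                          ≈⟨ Δ-shift α γ (sαm R γ 0) i ⟩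
        Δ γ (sαm R γ 0) i + (γ - α) * sαm R γ 0 i  ≈⟨ +-congʳ (Δ-sαm-zero γ i) ⟩
        0# + (γ - α) * sαm R γ 0 i                 ≈⟨ +-identityˡ _ ⟩
        (γ - α) * sαm R γ 0 i                      ∎
    Δ-onto-sαm α γ {m} γ≉α (suc b) b+1<m =
      let (e , e≉0 , y , y∈ , Δy∼es₀) = Δ-onto-sαm α γ γ≉α b (<⇒≤ b+1<m)
      in e * (γ - α) , *-nonzero e≉0 γ≉α , e ⊙ s₁ ⊖ y ,
         ⊖-closed (⊙-closed e (sαm∈RootSpan γ b+1<m)) y∈ , λ i → begin
           Δ α (e ⊙ s₁ ⊖ y) i
             ≈⟨ ⊖-homo (e ⊙ s₁) y i ⟩
           Δ α (e ⊙ s₁) i - Δ α y i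
             ≈⟨ +-cong (⊙-homo e s₁ i) (-‿cong (Δy∼es₀ i)) ⟩
           e * Δ α s₁ i - e * s₀ i
             ≈⟨ +-congʳ (*-congˡ (trans (Δ-shift α γ s₁ i) (+-congʳ (Δ-sαm-suc γ b i)))) ⟩
           e * (s₀ i + (γ - α) * s₁ i) - e * s₀ i
             ≈⟨ +-congʳ (trans (distribˡ e _ _) (+-congˡ (sym (*-assoc e _ _)))) ⟩
           (e * s₀ i + e * (γ - α) * s₁ i) - e * s₀ i
             ≈⟨ xyx⁻¹≈y _ _ ⟩
           e * (γ - α) * s₁ i
             ∎
      where
      open IsSubmodule (rootSpan-isSubmodule γ m)
      open IsLinear (evalL-isLinear (linear R α))
      s₀ s₁ : Seq R
      s₀ = sαm R γ b
      s₁ = sαm R γ (suc b)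

    Δ-surjectiveModTorsion : ∀ α γ → ¬ γ - α ≈ 0# → ∀ m →
      SurjectiveModTorsion (Δ α) (RootSpan γ m)
    Δ-surjectiveModTorsion α γ γ≉α m = span-minimal
      (torsion-isSubmodule
        (image-isSubmodule (evalL-isLinear (linear R α)) (rootSpan-isSubmodule γ m)))
      (λ a → Δ-onto-sαm α γ γ≉α (toℕ a) (toℕ<n a))

    rootProduct-surjectiveModTorsion-RootSpan : ∀ k α μ γ → (∀ u → ¬ γ - α u ≈ 0#) → ∀ m →
      SurjectiveModTorsion (evalL R (rootProduct R k α μ)) (RootSpan γ m)
    rootProduct-surjectiveModTorsion-RootSpan k α μ γ γ≉α m =
      rootProduct-surjectiveModTorsion k α μ λ u →
        powP-surjectiveModTorsion (linear R (α u)) (μ u)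
          (Δ-surjectiveModTorsion (α u) γ (γ≉α u) m)

    kernel-torsion-mod-InSpan : ∀ k α μ → (∀ u v → α u ≈ α v → u ≡ v) →
      ∀ {s} → evalL R (rootProduct R k α μ) s ∼ 𝟎 → Torsion (InSpan R k α μ) s
    kernel-torsion-mod-InSpan zero α μ α-inj {s} s∈ker =
      1# , proj₁ domain , (λ ()) , λ i →
        trans (*-congˡ (trans (sym (evalL-unit s i)) (s∈ker i))) (zeroʳ 1#)
    kernel-torsion-mod-InSpan (suc k) α μ α-inj {s} s∈ker =
      let (e , e≉0 , y , y∈ , Q[es-y]∼𝟎) =
            surjectiveModTorsion⇒kernel (evalL-isLinear (rootProduct R k α′ μ′))
              (rootProduct-surjectiveModTorsion-RootSpan k α′ μ′ α₀ α₀≉α′ μ₀)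
              (rootProduct-suc-kernel α μ s∈ker)
          (f , f≉0 , f[es-y]∈) = kernel-torsion-mod-InSpan k α′ μ′ α′-inj Q[es-y]∼𝟎
      in f * e , *-nonzero f≉0 e≉0 , InSpan-resp α μ (⊙-⊕-⊖ f e s y)
           (InSpan-suc α μ (IsSubmodule.⊙-closed (rootSpan-isSubmodule α₀ μ₀) f y∈) f[es-y]∈)
      where
      α₀ : Carrier
      α₀ = α Fin.zero
      μ₀ : ℕ
      μ₀ = μ Fin.zero
      α′ : Fin k → Carrier
      α′ = α ∘ Fin.suc
      μ′ : Fin k → ℕ
      μ′ = μ ∘ Fin.suc

      α′-inj : ∀ u v → α′ u ≈ α′ v → u ≡ v
      α′-inj u v α′u≈α′v = suc-injective (α-inj _ _ α′u≈α′v)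

      α₀≉α′ : ∀ u → ¬ α₀ - α′ u ≈ 0#
      α₀≉α′ u α₀-α′u≈0 with α-inj Fin.zero (Fin.suc u) (x∙y⁻¹≈ε⇒x≈y _ _ α₀-α′u≈0)
      ... | ()

theorem7p5 : ∀ {c ℓ} (R : CommutativeRing c ℓ) → IsDomain R →
    (n : ℕ) (cs : Vec (CommutativeRing.Carrier R) n)
    (k : ℕ) (α : Fin k → CommutativeRing.Carrier R) (μ : Fin k → ℕ) →
    (∀ u v → CommutativeRing._≈_ R (α u) (α v) → u ≡ v) →
    (∀ u → μ u ≥ 1) →
    _≈P_ R (monic R cs) (rootProduct R k α μ) →
    (s : Seq R) → InKer R (monic R cs) s →
    ∃ λ (d : CommutativeRing.Carrier R) →
    ¬ (CommutativeRing._≈_ R d (CommutativeRing.0# R)) ×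
    InSpan R k α μ (λ i → CommutativeRing._*_ R d (s i))
theorem7p5 R domain n cs k α μ α-inj _ p≈∏ s s∈ker =
  kernel-torsion-mod-InSpan R domain k α μ α-inj λ i →
    trans (sym (evalL-≈P R (monic R cs) (rootProduct R k α μ) p≈∏ s i)) (s∈ker i)
  where open CommutativeRing R using (trans; sym)
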